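{- Let $V=\mathbb{F}_2^n$, $n\ge 3$, and let $\mathcal{C}$ be a $3$-element clique of the graph $\Gamma_1$ on the non-singular points of $\mathrm{PG}(2n-1,2)$. Then the three points of $\mathcal{C}$ form a line of $\mathrm{PG}(2n-1,2)$ if and only if the following condition holds: (NS) every non-singular point $\mathbf{p}\notin\mathcal{C}$ is adjacent in $\Gamma_1$ to precisely two points of $\mathcal{C}$ or to no point of $\mathcal{C}$.
   Context: On $W=V\times V^*$ define the quadratic form $Q(x,x^*)=x^*(x)$. A point $\langle w\rangle$ of $\mathrm{PG}(2n-1,2)=\mathrm{PG}(W)$ is singular if $Q(w)=0$, non-singular otherwise. The map $f:\langle (x,x^*)\rangle\mapsto(\langle x\rangle,\ker x^*)$ is a bijection from non-singular points to anti-flags of $\mathrm{PG}(n-1,2)$ (pairs $(p,H)$, $p$ a point, $H$ a hyperplane, $p\notin H$). Two distinct non-singular points $\mathbf{p}_1,\mathbf{p}_2$ are adjacent in $\Gamma_1$ iff, writing $f(\mathbf{p}_j)=(p_j,H_j)$, one has $p_j\in H_{3-j}$ and $p_{3-j}\notin H_j$ for some $j\in\{1,2\}$; equivalently, the third point of the line $\langle\mathbf{p}_1,\mathbf{p}_2\rangle$ is non-singular. -}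

module Defs where

open import Data.Bool using (Bool; true; false; _∧_; _xor_; if_then_else_)
open import Data.Nat using (ℕ; _+_)
open import Data.Vec using (Vec; zipWith; foldr)
open import Data.Product using (_×_; _,_)
open import Relation.Binary.PropositionalEquality using (_≡_; _≢_)
open import Relation.Nullary using (¬_)
open import Data.Sum using (_⊎_)

-- F₂ is modelled by Bool (false = 0, true = 1, _xor_ = +, _∧_ = ·).
-- V = F₂ⁿ, V* = F₂ⁿ with the standard dual pairing.
V : ℕ → Set
V n = Vec Bool n

eval : ∀ {n} → V n → V n → Bool
eval xs x = foldr _ _xor_ false (zipWith _∧_ xs x)

-- W = V × V*.  Over F₂ a projective point ⟨w⟩ of PG(W) is exactly a nonzero
-- vector w (the only nonzero scalar is 1); non-singular vectors are automatically nonzero.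
W : ℕ → Set
W n = V n × V n

_⊕_ : ∀ {n} → W n → W n → W n
(x , xs) ⊕ (y , ys) = zipWith _xor_ x y , zipWith _xor_ xs ys

Q : ∀ {n} → W n → Bool
Q (x , xs) = eval xs x

NonSingular : ∀ {n} → W n → Set
NonSingular w = Q w ≡ true

-- anti-flag incidence: under f, ⟨(x,x*)⟩ ↦ (⟨x⟩, ker x*).
-- "point of p lies in hyperplane of q":  p ∈ H  iff  x_q*(x_p) = 0
_∈H_ : ∀ {n} → W n → W n → Set
(x , _) ∈H (_ , ys) = eval ys x ≡ false

_∉H_ : ∀ {n} → W n → W n → Set
(x , _) ∉H (_ , ys) = eval ys x ≡ true

data Adj {n : ℕ} (p₁ p₂ : W n) : Set where
  adj₁ : p₁ ≢ p₂ → p₁ ∈H p₂ → p₂ ∉H p₁ → Adj p₁ p₂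
  adj₂ : p₁ ≢ p₂ → p₂ ∈H p₁ → p₁ ∉H p₂ → Adj p₁ p₂

record Clique3 {n : ℕ} (a b c : W n) : Set where
  field
    nsa : NonSingular a
    nsb : NonSingular b
    nsc : NonSingular c
    ab  : Adj a b
    ac  : Adj a c
    bc  : Adj b c

-- three distinct points of PG(W) over F₂ form a line iff they are {a, b, a+b}
IsLine : ∀ {n} → W n → W n → W n → Set
IsLine a b c = a ⊕ b ≡ c

TwoOrNone : ∀ {n} → W n → W n → W n → W n → Set
TwoOrNone p a b c =
    (Adj p a × Adj p b × ¬ Adj p c)
  ⊎ (Adj p a × ¬ Adj p b × Adj p c)
  ⊎ (¬ Adj p a × Adj p b × Adj p c)
  ⊎ (¬ Adj p a × ¬ Adj p b × ¬ Adj p c)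

NS : ∀ {n} → W n → W n → W n → Set
NS {n} a b c = (p : W n) → NonSingular p → p ≢ a → p ≢ b → p ≢ c → TwoOrNone p a b c

-- Two distinct points are adjacent in Γ₁ exactly when the polar form of Q takes the value 1 on
-- them, so a point p outside {a, b, c} is adjacent to an even number of them iff p is orthogonal
-- to d = a ⊕ b ⊕ c. If c = a ⊕ b then d = 0. Conversely, (NS) makes d orthogonal to every
-- non-singular point outside the clique, and pairwise adjacency makes it orthogonal to a, b, c as
-- well. For n ≥ 2 the non-singular points (eᵢ, eᵢ) and (eᵢ + eⱼ, eⱼ), j ≠ i, already detect every
-- coordinate of a vector through the polar form, so d = 0.
module Submission where

open import Defs
open import Algebra using (CommutativeRing)
open import Data.Bool using (Bool; true; false; _∧_; _xor_)
open import Data.Bool.Properties as Bool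
  using ( ∧-comm; ∧-zeroʳ; ∧-identityʳ; ∧-distribˡ-xor
        ; xor-comm; xor-assoc; xor-same; xor-identityʳ; xor-∧-commutativeRing )
open import Data.Fin using (Fin; zero; suc; punchIn)
open import Data.Fin.Properties using (punchInᵢ≢i)
open import Data.Nat using (ℕ; suc; _≤_; s≤s; z≤n)
open import Data.Nat.Properties using (<⇒≤)
open import Data.Product using (_×_; _,_)
open import Data.Product.Properties as Product using ()
open import Data.Sum using (inj₁; inj₂)
open import Data.Vec using ([]; _∷_; zipWith; replicate; lookup; _[_]≔_)
open import Data.Vec.Properties as Vec using (lookup-replicate; lookup∘update; lookup∘update′)
open import Data.Vec.Relation.Binary.Pointwise.Extensional using (ext; Pointwise-≡⇒≡)
open import Relation.Binary.Definitions using (DecidableEquality)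
open import Relation.Binary.PropositionalEquality
  using (_≡_; _≢_; refl; sym; trans; cong; cong₂; module ≡-Reasoning)
open import Relation.Nullary using (¬_; yes; no)

open import Algebra.Properties.CommutativeSemigroup
  (CommutativeRing.+-commutativeSemigroup xor-∧-commutativeRing)
  using () renaming (interchange to xor-interchange)
open import Algebra.Properties.Group (CommutativeRing.+-group xor-∧-commutativeRing)
  using () renaming (∙-cancelˡ to xor-cancelˡ; ∙-cancelʳ to xor-cancelʳ)

open ≡-Reasoning

private
  variable
    n : ℕ

infixl 6 _+ᵥ_

_+ᵥ_ : V n → V n → V n
_+ᵥ_ = zipWith _xor_

unit : Fin n → V n
unit i = replicate _ false [ i ]≔ true

eval-comm : (u x : V n) → eval u x ≡ eval x u
eval-comm []       []       = refl
eval-comm (a ∷ u) (b ∷ x) = cong₂ _xor_ (∧-comm a b) (eval-comm u x)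

eval-distribˡ-+ᵥ : (u x y : V n) → eval u (x +ᵥ y) ≡ eval u x xor eval u y
eval-distribˡ-+ᵥ []      []      []      = refl
eval-distribˡ-+ᵥ (a ∷ u) (b ∷ x) (c ∷ y) = begin
  a ∧ (b xor c) xor eval u (x +ᵥ y)
    ≡⟨ cong₂ _xor_ (∧-distribˡ-xor a b c) (eval-distribˡ-+ᵥ u x y) ⟩
  (a ∧ b xor a ∧ c) xor (eval u x xor eval u y)
    ≡⟨ xor-interchange (a ∧ b) (a ∧ c) (eval u x) (eval u y) ⟩
  (a ∧ b xor eval u x) xor (a ∧ c xor eval u y)
    ∎

eval-distribʳ-+ᵥ : (u v x : V n) → eval (u +ᵥ v) x ≡ eval u x xor eval v x
eval-distribʳ-+ᵥ u v x = begin
  eval (u +ᵥ v) x           ≡⟨ eval-comm (u +ᵥ v) x ⟩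
  eval x (u +ᵥ v)           ≡⟨ eval-distribˡ-+ᵥ x u v ⟩
  eval x u xor eval x v     ≡⟨ cong₂ _xor_ (eval-comm x u) (eval-comm x v) ⟩
  eval u x xor eval v x     ∎

eval-zeroʳ : (u : V n) → eval u (replicate n false) ≡ false
eval-zeroʳ []      = refl
eval-zeroʳ (a ∷ u) = cong₂ _xor_ (∧-zeroʳ a) (eval-zeroʳ u)

eval-unitʳ : (u : V n) (i : Fin n) → eval u (unit i) ≡ lookup u i
eval-unitʳ (a ∷ u) zero    = trans (cong₂ _xor_ (∧-identityʳ a) (eval-zeroʳ u)) (xor-identityʳ a)
eval-unitʳ (a ∷ u) (suc i) = cong₂ _xor_ (∧-zeroʳ a) (eval-unitʳ u i)

eval-unitˡ : (i : Fin n) (x : V n) → eval (unit i) x ≡ lookup x i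
eval-unitˡ i x = trans (eval-comm (unit i) x) (eval-unitʳ x i)

lookup-unit-self : (i : Fin n) → lookup (unit i) i ≡ true
lookup-unit-self {n} i = lookup∘update i (replicate n false) true

lookup-unit-≢ : {i j : Fin n} → j ≢ i → lookup (unit i) j ≡ false
lookup-unit-≢ {n} {i} {j} j≢i =
  trans (lookup∘update′ j≢i (replicate n false) true) (lookup-replicate j false)

-- The polar form of Q: polar p q = Q (p ⊕ q) xor Q p xor Q q.
polar : W n → W n → Bool
polar (x , x*) (y , y*) = eval y* x xor eval x* y

polar-comm : (p q : W n) → polar p q ≡ polar q p
polar-comm (x , x*) (y , y*) = xor-comm (eval y* x) (eval x* y)

polar-self : (p : W n) → polar p p ≡ false
polar-self (x , x*) = xor-same (eval x* x)

polar-distribˡ-⊕ : (p q r : W n) → polar p (q ⊕ r) ≡ polar p q xor polar p r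
polar-distribˡ-⊕ (x , x*) (y , y*) (z , z*) = begin
  eval (y* +ᵥ z*) x xor eval x* (y +ᵥ z)
    ≡⟨ cong₂ _xor_ (eval-distribʳ-+ᵥ y* z* x) (eval-distribˡ-+ᵥ x* y z) ⟩
  (eval y* x xor eval z* x) xor (eval x* y xor eval x* z)
    ≡⟨ xor-interchange (eval y* x) (eval z* x) (eval x* y) (eval x* z) ⟩
  (eval y* x xor eval x* y) xor (eval z* x xor eval x* z)
    ∎

Adj⇒polar : {p q : W n} → Adj p q → polar p q ≡ true
Adj⇒polar (adj₁ _ p∈Hq q∉Hp) = cong₂ _xor_ p∈Hq q∉Hp
Adj⇒polar (adj₂ _ q∈Hp p∉Hq) = cong₂ _xor_ p∉Hq q∈Hp

polar⇒Adj : {p q : W n} → p ≢ q → polar p q ≡ true → Adj p q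
polar⇒Adj {p = x , x*} {y , y*} p≢q h with eval y* x in e₁ | eval x* y in e₂
polar⇒Adj p≢q _  | false | true  = adj₁ p≢q e₁ e₂
polar⇒Adj p≢q _  | true  | false = adj₂ p≢q e₂ e₁
polar⇒Adj p≢q () | false | false
polar⇒Adj p≢q () | true  | true

polar≡false⇒¬Adj : {p q : W n} → polar p q ≡ false → ¬ Adj p q
polar≡false⇒¬Adj h adj with () ← trans (sym (Adj⇒polar adj)) h

¬Adj⇒polar≡false : {p q : W n} → p ≢ q → ¬ Adj p q → polar p q ≡ false
¬Adj⇒polar≡false p≢q ¬adj = Bool.¬-not (λ h → ¬adj (polar⇒Adj p≢q h))

module _ {p a b c : W n} (p≢a : p ≢ a) (p≢b : p ≢ b) (p≢c : p ≢ c) where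

  TwoOrNone⇒polar-parity : TwoOrNone p a b c → polar p a xor polar p b ≡ polar p c
  TwoOrNone⇒polar-parity (inj₁ (pa , pb , ¬pc)) =
    trans (cong₂ _xor_ (Adj⇒polar pa) (Adj⇒polar pb)) (sym (¬Adj⇒polar≡false p≢c ¬pc))
  TwoOrNone⇒polar-parity (inj₂ (inj₁ (pa , ¬pb , pc))) =
    trans (cong₂ _xor_ (Adj⇒polar pa) (¬Adj⇒polar≡false p≢b ¬pb)) (sym (Adj⇒polar pc))
  TwoOrNone⇒polar-parity (inj₂ (inj₂ (inj₁ (¬pa , pb , pc)))) =
    trans (cong₂ _xor_ (¬Adj⇒polar≡false p≢a ¬pa) (Adj⇒polar pb)) (sym (Adj⇒polar pc))
  TwoOrNone⇒polar-parity (inj₂ (inj₂ (inj₂ (¬pa , ¬pb , ¬pc)))) =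
    trans (cong₂ _xor_ (¬Adj⇒polar≡false p≢a ¬pa) (¬Adj⇒polar≡false p≢b ¬pb))
          (sym (¬Adj⇒polar≡false p≢c ¬pc))

  polar-parity⇒TwoOrNone : polar p a xor polar p b ≡ polar p c → TwoOrNone p a b c
  polar-parity⇒TwoOrNone h with polar p a in pa | polar p b in pb
  ... | true  | true  =
    inj₁ (polar⇒Adj p≢a pa , polar⇒Adj p≢b pb , polar≡false⇒¬Adj (sym h))
  ... | true  | false =
    inj₂ (inj₁ (polar⇒Adj p≢a pa , polar≡false⇒¬Adj pb , polar⇒Adj p≢c (sym h)))
  ... | false | true  =
    inj₂ (inj₂ (inj₁ (polar≡false⇒¬Adj pa , polar⇒Adj p≢b pb , polar⇒Adj p≢c (sym h))))
  ... | false | false =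
    inj₂ (inj₂ (inj₂ (polar≡false⇒¬Adj pa , polar≡false⇒¬Adj pb , polar≡false⇒¬Adj (sym h))))

nonSingular-unit-unit : (i : Fin n) → NonSingular (unit i , unit i)
nonSingular-unit-unit i = trans (eval-unitˡ i (unit i)) (lookup-unit-self i)

nonSingular-unit+unit-unit : {i j : Fin n} → j ≢ i → NonSingular (unit i +ᵥ unit j , unit j)
nonSingular-unit+unit-unit {i = i} {j} j≢i = begin
  eval (unit j) (unit i +ᵥ unit j)
    ≡⟨ eval-unitˡ j (unit i +ᵥ unit j) ⟩
  lookup (unit i +ᵥ unit j) j
    ≡⟨ Vec.lookup-zipWith _xor_ j (unit i) (unit j) ⟩
  lookup (unit i) j xor lookup (unit j) j
    ≡⟨ cong₂ _xor_ (lookup-unit-≢ j≢i) (lookup-unit-self j) ⟩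
  true
    ∎

polar-unit-unit : (i : Fin n) (y y* : V n) →
                  polar (unit i , unit i) (y , y*) ≡ lookup y* i xor lookup y i
polar-unit-unit i y y* = cong₂ _xor_ (eval-unitʳ y* i) (eval-unitˡ i y)

polar-unit+unit-unit : (i j : Fin n) (y y* : V n) →
                       polar (unit i +ᵥ unit j , unit j) (y , y*)
                         ≡ (lookup y* i xor lookup y* j) xor lookup y j
polar-unit+unit-unit i j y y* = cong₂ _xor_ y*-part (eval-unitˡ j y)
  where
  y*-part : eval y* (unit i +ᵥ unit j) ≡ lookup y* i xor lookup y* j
  y*-part = trans (eval-distribˡ-+ᵥ y* (unit i) (unit j))
                  (cong₂ _xor_ (eval-unitʳ y* i) (eval-unitʳ y* j))

nonSingular-separates : 2 ≤ n → (u v : W n) →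
                        (∀ p → NonSingular p → polar p u ≡ polar p v) → u ≡ v
nonSingular-separates {suc (suc _)} (s≤s (s≤s z≤n)) (x , x*) (y , y*) agree =
  cong₂ _,_ (Pointwise-≡⇒≡ (ext primal)) (Pointwise-≡⇒≡ (ext dual))
  where
  diagonal : ∀ i → lookup x* i xor lookup x i ≡ lookup y* i xor lookup y i
  diagonal i = begin
    lookup x* i xor lookup x i               ≡⟨ polar-unit-unit i x x* ⟨
    polar (unit i , unit i) (x , x*)         ≡⟨ agree (unit i , unit i) (nonSingular-unit-unit i) ⟩
    polar (unit i , unit i) (y , y*)         ≡⟨ polar-unit-unit i y y* ⟩
    lookup y* i xor lookup y i               ∎

  dual : ∀ i → lookup x* i ≡ lookup y* i
  dual i = xor-cancelʳ (lookup x* j xor lookup x j) (lookup x* i) (lookup y* i) (begin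
    lookup x* i xor (lookup x* j xor lookup x j)   ≡⟨ xor-assoc (lookup x* i) _ _ ⟨
    (lookup x* i xor lookup x* j) xor lookup x j   ≡⟨ polar-unit+unit-unit i j x x* ⟨
    polar (unit i +ᵥ unit j , unit j) (x , x*)
      ≡⟨ agree (unit i +ᵥ unit j , unit j) (nonSingular-unit+unit-unit j≢i) ⟩
    polar (unit i +ᵥ unit j , unit j) (y , y*)     ≡⟨ polar-unit+unit-unit i j y y* ⟩
    (lookup y* i xor lookup y* j) xor lookup y j   ≡⟨ xor-assoc (lookup y* i) _ _ ⟩
    lookup y* i xor (lookup y* j xor lookup y j)   ≡⟨ cong (lookup y* i xor_) (diagonal j) ⟨
    lookup y* i xor (lookup x* j xor lookup x j)   ∎)
    where
    j = punchIn i zero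
    j≢i : j ≢ i
    j≢i = punchInᵢ≢i i zero

  primal : ∀ i → lookup x i ≡ lookup y i
  primal i = xor-cancelˡ (lookup x* i) (lookup x i) (lookup y i)
    (trans (diagonal i) (cong (_xor lookup y i) (sym (dual i))))

_≟W_ : DecidableEquality (W n)
_≟W_ = Product.≡-dec (Vec.≡-dec Bool._≟_) (Vec.≡-dec Bool._≟_)

IsLine⇒NS : {a b c : W n} → IsLine a b c → NS a b c
IsLine⇒NS {a = a} {b} refl p _ p≢a p≢b p≢c =
  polar-parity⇒TwoOrNone p≢a p≢b p≢c (sym (polar-distribˡ-⊕ p a b))

NS⇒IsLine : 2 ≤ n → {a b c : W n} → Adj a b → Adj a c → Adj b c → NS a b c → IsLine a b c
NS⇒IsLine 2≤n {a} {b} {c} ab ac bc ns = nonSingular-separates 2≤n (a ⊕ b) c agree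
  where
  agree : ∀ p → NonSingular p → polar p (a ⊕ b) ≡ polar p c
  agree p nsp with p ≟W a | p ≟W b | p ≟W c
  ... | yes refl | _ | _ = begin
    polar a (a ⊕ b)            ≡⟨ polar-distribˡ-⊕ a a b ⟩
    polar a a xor polar a b    ≡⟨ cong₂ _xor_ (polar-self a) (Adj⇒polar ab) ⟩
    true                       ≡⟨ Adj⇒polar ac ⟨
    polar a c                  ∎
  ... | no _ | yes refl | _ = begin
    polar b (a ⊕ b)            ≡⟨ polar-distribˡ-⊕ b a b ⟩
    polar b a xor polar b b    ≡⟨ cong₂ _xor_ (trans (polar-comm b a) (Adj⇒polar ab))
                                              (polar-self b) ⟩
    true                       ≡⟨ Adj⇒polar bc ⟨
    polar b c                  ∎
  ... | no _ | no _ | yes refl = begin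
    polar c (a ⊕ b)            ≡⟨ polar-distribˡ-⊕ c a b ⟩
    polar c a xor polar c b    ≡⟨ cong₂ _xor_ (trans (polar-comm c a) (Adj⇒polar ac))
                                              (trans (polar-comm c b) (Adj⇒polar bc)) ⟩
    false                      ≡⟨ polar-self c ⟨
    polar c c                  ∎
  ... | no p≢a | no p≢b | no p≢c =
    trans (polar-distribˡ-⊕ p a b)
          (TwoOrNone⇒polar-parity p≢a p≢b p≢c (ns p nsp p≢a p≢b p≢c))

proposition8 : (n : ℕ) → 3 ≤ n → (a b c : W n) → Clique3 a b c
    → (IsLine a b c → NS a b c) × (NS a b c → IsLine a b c)
proposition8 n 3≤n a b c clique = IsLine⇒NS , NS⇒IsLine (<⇒≤ 3≤n) ab ac bc
  where open Clique3 clique
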